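{- For every non-deterministic pointer machine $M$ that decides a set $S$, there exists an acyclic non-deterministic pointer machine $M'$ that decides $S$.
   Context: Non-deterministic pointer machines (NDPM): an NDPM with $p\ge1$ pointers is a pair $M=(Q,\to)$ with $Q$ a set of states and $\to\subseteq(\{0,1,\star\}^p\times Q)\times((I^p\times Q)\cup\{\mathbf{accept},\mathbf{reject}\})$, where the $i$-th component of an element of $I^p$ is one of $p_i+$ (move pointer $i$ one cell forward), $p_i-$ (one cell backward), $\epsilon_i$ (do not move). Elements of $\{0,1,\star\}^p\times Q$ are pseudo-configurations (last stored value of each pointer and current state; addresses not included); $C_M$ denotes their set. Inputs are binary words $a_1\cdots a_k$; the tape is circular and contains $\star a_1\cdots a_k$. $M_c(n)$ denotes the run started in pseudo-configuration $c$ with all pointers on $\star$. At each step a transition from the current pseudo-configuration is chosen non-deterministically (all choices are branches); target $\mathbf{accept}$/$\mathbf{reject}$ ends the branch accordingly; otherwise pointers move as instructed, a pointer that moved stores the symbol at its new position, and the state changes; if no transition applies the branch accepts. $n$ is accepted if every branch of $M_c(n)$ reaches accept after finitely many transitions, rejected if some branch reaches reject; $M_c(n)$ halts if it accepts or rejects. $M$ decides $S$ if some $c\in C_M$ satisfies: $M_c(n)$ accepts iff $n\in S$. $M$ is acyclic if for every $c\in C_M$ and every input $n$, $M_c(n)$ halts. -}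

module Defs where

open import Data.Nat using (ℕ; zero; suc; _+_; _≤_)
open import Data.Nat.DivMod using (_mod_)
open import Data.Fin using (Fin; toℕ)
open import Data.Bool using (Bool; true; false)
open import Data.List using (List; length)
import Data.List as List
open import Data.Vec using (Vec; zipWith; replicate; _∷_; [])
open import Data.Product using (Σ; _×_; _,_)
open import Data.Sum using (_⊎_)
open import Relation.Binary.PropositionalEquality using (_≡_)

data Sym : Set where
  s0 s1 star : Sym

data Instr : Set where
  fwd bwd eps : Instr

PseudoConfig : ℕ → ℕ → Set
PseudoConfig p q = Vec Sym p × Fin q

data Target (p q : ℕ) : Set where
  accept : Target p q
  reject : Target p q
  go     : Vec Instr p → Fin q → Target p q

record NDPM : Set where
  field
    p     : ℕ
    p≥1   : 1 ≤ p
    q     : ℕ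
    trans : PseudoConfig p q → Target p q → Bool

open NDPM public

-- The circular tape of input w = a₁⋯a_k has k+1 cells: ⋆ a₁ ⋯ a_k,
-- cell 0 holds ⋆ and cell j+1 holds a_{j+1}.
Cell : List Bool → Set
Cell w = Fin (suc (length w))

bitSym : Bool → Sym
bitSym false = s0
bitSym true  = s1

readCell : (w : List Bool) → Cell w → Sym
readCell w Fin.zero    = star
readCell w (Fin.suc j) = bitSym (List.lookup w j)

moveAddr : (w : List Bool) → Instr → Cell w → Cell w
moveAddr w fwd i = suc (toℕ i) mod suc (length w)
moveAddr w bwd i = (toℕ i + length w) mod suc (length w)
moveAddr w eps i = i

newVal : (w : List Bool) → Instr → Cell w → Sym → Sym
newVal w eps i v = v
newVal w fwd i v = readCell w (moveAddr w fwd i)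
newVal w bwd i v = readCell w (moveAddr w bwd i)

record Config (M : NDPM) (w : List Bool) : Set where
  constructor cfg
  field
    addrs : Vec (Cell w) (p M)
    vals  : Vec Sym (p M)
    state : Fin (q M)

open Config public

pseudo : {M : NDPM} {w : List Bool} → Config M w → PseudoConfig (p M) (q M)
pseudo c = vals c , state c

step : {M : NDPM} {w : List Bool} → Config M w → Vec Instr (p M) → Fin (q M) → Config M w
step {M} {w} c is s =
  cfg (zipWith (moveAddr w) is (addrs c))
      (zipWith (λ { (i , a) v → newVal w i a v }) (zipWith _,_ is (addrs c)) (vals c))
      s

init : (M : NDPM) (w : List Bool) → PseudoConfig (p M) (q M) → Config M w
init M w (vs , s) = cfg (replicate _ Fin.zero) vs s

-- Every branch reaches accept after finitely many transitions
-- (inductive: all branches are finite; a configuration with no applicable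
-- transition accepts).
mutual
  data Accepts {M : NDPM} {w : List Bool} (c : Config M w) : Set where
    acc : (∀ t → trans M (pseudo c) t ≡ true → AcceptsT c t) → Accepts c

  data AcceptsT {M : NDPM} {w : List Bool} (c : Config M w) : Target (p M) (q M) → Set where
    t-accept : AcceptsT c accept
    t-go     : ∀ {is s} → Accepts (step c is s) → AcceptsT c (go is s)

data Rejects {M : NDPM} {w : List Bool} (c : Config M w) : Set where
  rej-now  : trans M (pseudo c) reject ≡ true → Rejects c
  rej-step : ∀ {is s} → trans M (pseudo c) (go is s) ≡ true →
             Rejects (step c is s) → Rejects c

Halts : {M : NDPM} {w : List Bool} → Config M w → Set
Halts c = Accepts c ⊎ Rejects c

Decides : NDPM → (List Bool → Set) → Set
Decides M S = Σ (PseudoConfig (p M) (q M)) λ c →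
  ∀ w → (Accepts (init M w c) → S w) × (S w → Accepts (init M w c))

Acyclic : NDPM → Set
Acyclic M = ∀ (c : PseudoConfig (p M) (q M)) (w : List Bool) → Halts (init M w c)

module Submission where

-- M′ runs M on P pointers and keeps, on P further pointers plus a clock
-- component of its state, a counter of the transitions taken.  The counter
-- pointers form an odometer in base n = |w| + 1 (cell 0, holding ⋆, being the
-- largest digit); each transition of M′ is a transition of M together with one
-- increment `inc` of the odometer, and each wrap-around of the odometer
-- advances the clock.  When the clock is at its top value T₀ = 3 ^ P · Q (Q the
-- number of states of M, P its number of pointers) and
-- the odometer is full, M′ rejects.
--
--  * Acyclicity: every transition of M′ decreases, lexicographically, the
--    remaining clock budget and a bounded potential of the counter block
--    (defined for arbitrary stored values, since M′ may start anywhere).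
--  * Soundness: accepting runs of M′ project to accepting runs of M.
--  * Completeness: an accepting configuration of M lies on no cycle, so an
--    accepting computation visits pairwise distinct configurations, of which
--    there are at most T₀ · n ^ P; hence the counter started on ⋆ never
--    overflows and M′ follows M all the way.

open import Defs
open import Data.Nat using (ℕ; zero; suc; _+_; _*_; _∸_; _^_; _≤_; _<_; z≤n; s≤s; s≤s⁻¹)
import Data.Nat as ℕ
open import Data.Nat.Properties hiding (_≟_)
open import Data.Nat.DivMod using (m<n⇒m%n≡m; n%n≡0)
open import Data.Nat.Induction using (<-wellFounded)
open import Data.Fin using (Fin; zero; suc; toℕ; fromℕ<; combine; quotient; remainder)
import Data.Fin.Properties as Fin
open import Data.Bool using (Bool; true; false)
import Data.Bool as Bool
open import Data.List using (List; length)
import Data.List as List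
open import Data.Vec using (Vec; []; _∷_; _++_; zipWith; replicate; map; take; drop)
open import Data.Vec.Properties
  using (take-zipWith; drop-zipWith; take++drop≡id; ++-injectiveˡ; ++-injectiveʳ; map-replicate; ≡-dec)
open import Data.Vec.Relation.Unary.All as All using (All; []; _∷_)
open import Data.Vec.Relation.Unary.AllPairs using ([]; _∷_)
open import Data.Vec.Relation.Unary.Unique.Propositional using (Unique)
open import Data.Vec.Relation.Unary.Unique.Propositional.Properties using (lookup-injective)
open import Data.Product using (Σ; ∃; _×_; _,_; proj₁; proj₂)
open import Data.Product.Relation.Binary.Lex.Strict using (×-Lex; ×-wellFounded)
open import Data.Sum using (_⊎_; inj₁; inj₂)
open import Data.Empty using (⊥; ⊥-elim)
open import Data.Unit using (⊤; tt)
open import Function using (_∘_; _$_; id)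
open import Function.Definitions using (Injective)
open import Induction.WellFounded using (WellFounded; Acc; acc)
open import Relation.Binary.Core using (Rel)
open import Relation.Binary.Definitions using (DecidableEquality)
open import Relation.Binary.Construct.Closure.ReflexiveTransitive using (Star; ε; _◅_; _◅◅_)
open import Relation.Binary.PropositionalEquality
  using (_≡_; _≢_; refl; sym; cong; cong₂; subst; subst₂; module ≡-Reasoning)
  renaming (trans to ≡-trans)
open import Relation.Nullary using (¬_; Dec; yes; no; does; ¬?; _×-dec_; _⊎-dec_)
open import Relation.Nullary.Decidable using (map′; dec-true)

does-true⇒ : ∀ {A : Set} (a? : Dec A) → does a? ≡ true → A
does-true⇒ (yes a) _ = a

-- The targets of a machine are searchable; this is what lets a configuration
-- whose successors all halt be classified as accepting or rejecting.
Searchable : Set → Set₁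
Searchable A = ∀ {G B : A → Set} → (∀ a → G a ⊎ B a) → (∀ a → G a) ⊎ ∃ B

searchable-Fin : ∀ n → Searchable (Fin n)
searchable-Fin zero _ = inj₁ λ ()
searchable-Fin (suc n) {G} {B} f with f zero | searchable-Fin n {G ∘ suc} {B ∘ suc} (f ∘ suc)
... | inj₂ b  | _            = inj₂ (zero , b)
... | inj₁ _  | inj₂ (a , b) = inj₂ (suc a , b)
... | inj₁ g  | inj₁ gs      = inj₁ λ { zero → g ; (suc a) → gs a }

searchable-Instr : Searchable Instr
searchable-Instr f with f fwd | f bwd | f eps
... | inj₂ b  | _       | _       = inj₂ (fwd , b)
... | inj₁ _  | inj₂ b  | _       = inj₂ (bwd , b)
... | inj₁ _  | inj₁ _  | inj₂ b  = inj₂ (eps , b)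
... | inj₁ g₁ | inj₁ g₂ | inj₁ g₃ = inj₁ λ { fwd → g₁ ; bwd → g₂ ; eps → g₃ }

searchable-Vec : ∀ {A} → Searchable A → ∀ n → Searchable (Vec A n)
searchable-Vec _ zero f with f []
... | inj₁ g = inj₁ λ { [] → g }
... | inj₂ b = inj₂ ([] , b)
searchable-Vec sA (suc n) {G} {B} f
  with sA {λ a → ∀ v → G (a ∷ v)} {λ a → ∃ λ v → B (a ∷ v)}
          (λ a → searchable-Vec sA n (λ v → f (a ∷ v)))
... | inj₁ g           = inj₁ λ { (a ∷ v) → g a v }
... | inj₂ (a , v , b) = inj₂ (a ∷ v , b)

module FinCoded {A : Set} {k : ℕ} (code : A → Fin k) (decode : Fin k → A)
                (decode-code : ∀ x → decode (code x) ≡ x) where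

  code-injective : Injective _≡_ _≡_ code
  code-injective {x} {y} e =
    ≡-trans (sym (decode-code x)) (≡-trans (cong decode e) (decode-code y))

  _≟_ : DecidableEquality A
  x ≟ y = map′ code-injective (cong code) (code x Fin.≟ code y)

module SymCode where
  code : Sym → Fin 3
  code s0   = zero
  code s1   = suc zero
  code star = suc (suc zero)

  decode : Fin 3 → Sym
  decode zero             = s0
  decode (suc zero)       = s1
  decode (suc (suc zero)) = star

  decode-code : ∀ x → decode (code x) ≡ x
  decode-code s0   = refl
  decode-code s1   = refl
  decode-code star = refl

  open FinCoded code decode decode-code public

module InstrCode where
  code : Instr → Fin 3
  code fwd = zero
  code bwd = suc zero
  code eps = suc (suc zero)

  decode : Fin 3 → Instr
  decode zero             = fwd
  decode (suc zero)       = bwd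
  decode (suc (suc zero)) = eps

  decode-code : ∀ x → decode (code x) ≡ x
  decode-code fwd = refl
  decode-code bwd = refl
  decode-code eps = refl

  open FinCoded code decode decode-code public

codeVec : ∀ {A : Set} {k m} → (A → Fin k) → Vec A m → Fin (k ^ m)
codeVec c []       = zero
codeVec c (x ∷ xs) = combine (c x) (codeVec c xs)

codeVec-injective : ∀ {A : Set} {k m} (c : A → Fin k) → Injective _≡_ _≡_ c →
                    Injective _≡_ _≡_ (codeVec {m = m} c)
codeVec-injective _ _ {[]}     {[]}     _ = refl
codeVec-injective c inj {x ∷ xs} {y ∷ ys} e
  with Fin.combine-injective (c x) (codeVec c xs) (c y) (codeVec c ys) e
... | ex , exs = cong₂ _∷_ (inj ex) (codeVec-injective c inj exs)

unique-length≤ : ∀ {A : Set} {N m} (c : A → Fin N) → Injective _≡_ _≡_ c →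
                 {xs : Vec A m} → Unique xs → m ≤ N
unique-length≤ c inj u = Fin.injective⇒≤ λ e → lookup-injective u _ _ (inj e)

take-++ : ∀ {A : Set} {m n} (xs : Vec A m) (ys : Vec A n) → take m (xs ++ ys) ≡ xs
take-++ {m = m} xs ys = ++-injectiveˡ (take m (xs ++ ys)) xs (take++drop≡id m (xs ++ ys))

drop-++ : ∀ {A : Set} {m n} (xs : Vec A m) (ys : Vec A n) → drop m (xs ++ ys) ≡ ys
drop-++ {m = m} xs ys = ++-injectiveʳ (take m (xs ++ ys)) xs (take++drop≡id m (xs ++ ys))

take-replicate : ∀ {A : Set} m {n} (x : A) → take m (replicate (m + n) x) ≡ replicate m x
take-replicate zero    x = refl
take-replicate (suc m) x = cong (x ∷_) (take-replicate m x)

drop-replicate : ∀ {A : Set} m {n} (x : A) → drop m (replicate (m + n) x) ≡ replicate n x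
drop-replicate zero    x = refl
drop-replicate (suc m) x = drop-replicate m x

cfg-cong : ∀ {M : NDPM} {w} {ps ps′ : Vec (Cell w) (p M)} {vs vs′ : Vec Sym (p M)} {s s′ : Fin (q M)} →
           ps ≡ ps′ → vs ≡ vs′ → s ≡ s′ → cfg {M} {w} ps vs s ≡ cfg ps′ vs′ s′
cfg-cong refl refl refl = refl

module Runs {N : NDPM} {w : List Bool} where

  data _⟶_ (X : Config N w) : Config N w → Set where
    ⟶-go : ∀ {is s} → trans N (pseudo X) (go is s) ≡ true → X ⟶ step X is s

  _⟶*_ : Config N w → Config N w → Set
  _⟶*_ = Star _⟶_

  _⟶⁺_ : Config N w → Config N w → Set
  X ⟶⁺ Z = ∃ λ Y → X ⟶ Y × Y ⟶* Z

  snoc⁺ : ∀ {X Y Z} → X ⟶* Y → Y ⟶ Z → X ⟶⁺ Z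
  snoc⁺ ε        t = _ , t , ε
  snoc⁺ (t ◅ ts) u = _ , t , ts ◅◅ (u ◅ ε)

  accepts-no-reject : ∀ {X : Config N w} → Accepts X → trans N (pseudo X) reject ≡ true → ⊥
  accepts-no-reject (acc f) e with f reject e
  ... | ()

  accepting-no-cycle : ∀ {X : Config N w} → Accepts X → ¬ (X ⟶⁺ X)
  accepting-no-cycle (acc f) (_ , ⟶-go {is} {s} e , path) with f (go is s) e
  ... | t-go a = accepting-no-cycle a (snoc⁺ path (⟶-go e))

  accepting-fresh : ∀ {X Y m} {vs : Vec (Config N w) m} →
                    Accepts Y → X ⟶ Y → All (_⟶* X) vs → All (Y ≢_) vs
  accepting-fresh {Y = Y} a t = All.map λ r eq →
    accepting-no-cycle a (subst (_⟶⁺ Y) (sym eq) (snoc⁺ r t))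

  LeadsToReject : Config N w → Target (p N) (q N) → Set
  LeadsToReject X accept    = ⊥
  LeadsToReject X reject    = ⊤
  LeadsToReject X (go is s) = Rejects (step X is s)

  -- Either some enabled target leads to rejection, found by searching the
  -- finitely many targets, or every enabled target leads to acceptance.
  halts-if-successors-halt : ∀ X → (∀ {Y} → X ⟶ Y → Halts Y) → Halts X
  halts-if-successors-halt X ih with classify reject | search-go
    where
    AcceptingBranch RejectingBranch : Target (p N) (q N) → Set
    AcceptingBranch tg = trans N (pseudo X) tg ≡ true → AcceptsT X tg
    RejectingBranch tg = trans N (pseudo X) tg ≡ true × LeadsToReject X tg

    enabled-halts : ∀ tg → trans N (pseudo X) tg ≡ true → AcceptsT X tg ⊎ LeadsToReject X tg
    enabled-halts accept    _ = inj₁ t-accept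
    enabled-halts reject    _ = inj₂ tt
    enabled-halts (go is s) e with ih (⟶-go e)
    ... | inj₁ a = inj₁ (t-go a)
    ... | inj₂ r = inj₂ r

    classify : ∀ tg → AcceptingBranch tg ⊎ RejectingBranch tg
    classify tg with trans N (pseudo X) tg in enabled
    ... | false = inj₁ λ ()
    ... | true with enabled-halts tg enabled
    ...   | inj₁ a = inj₁ λ _ → a
    ...   | inj₂ r = inj₂ (refl , r)

    search-go : (∀ is s → AcceptingBranch (go is s)) ⊎ ∃ λ is → ∃ λ s → RejectingBranch (go is s)
    search-go = searchable-Vec searchable-Instr (p N)
      (λ is → searchable-Fin (q N) (λ s → classify (go is s)))
  ... | inj₂ (e , _)         | _                       = inj₂ (rej-now e)
  ... | inj₁ _               | inj₂ (_ , _ , e , r)    = inj₂ (rej-step e r)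
  ... | inj₁ accepting-reject | inj₁ accepting-go =
    inj₁ (acc λ { accept _ → t-accept ; reject → accepting-reject ; (go is s) → accepting-go is s })

  halts-by-measure : ∀ {A : Set} {ℓ} {_≺_ : Rel A ℓ} → WellFounded _≺_ →
                     (μ : Config N w → A) → (∀ {X Y} → X ⟶ Y → μ Y ≺ μ X) →
                     ∀ X → Halts X
  halts-by-measure {_≺_ = _≺_} wf μ decreases X = go′ X (wf (μ X))
    where
    go′ : ∀ X → Acc _≺_ (μ X) → Halts X
    go′ X (acc rec) = halts-if-successors-halt X λ t → go′ _ (rec (decreases t))

open Runs

Full : ∀ {m} → Vec Sym m → Set
Full = All (_≡ star)

full? : ∀ {m} (cs : Vec Sym m) → Dec (Full cs)
full? = All.all? (SymCode._≟ star)

-- The increment of an odometer whose digit ⋆ is the largest one: every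
-- pointer moves forward up to and including the first one not storing ⋆.
inc : ∀ {m} → Vec Sym m → Vec Instr m
inc []          = []
inc (star ∷ cs) = fwd ∷ inc cs
inc (s0 ∷ cs)   = fwd ∷ replicate _ eps
inc (s1 ∷ cs)   = fwd ∷ replicate _ eps

¬full-tail : ∀ {m} {cs : Vec Sym m} → ¬ Full (star ∷ cs) → ¬ Full cs
¬full-tail ¬full full = ¬full (refl ∷ full)

module Tape (w : List Bool) where

  k n : ℕ
  k = length w
  n = suc k

  storedAfter : ∀ {m} → Vec Instr m → Vec (Cell w) m → Vec Sym m → Vec Sym m
  storedAfter is ps vs = zipWith _$_ (zipWith (newVal w) is ps) vs

  vals-step : ∀ {M : NDPM} (X : Config M w) is s →
              vals (step X is s) ≡ storedAfter is (addrs X) (vals X)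
  vals-step X is s = pairwise (λ _ _ _ → refl) is (addrs X) (vals X)
    where
    pairwise : ∀ {m} {g : Instr × Cell w → Sym → Sym} → (∀ i a v → g (i , a) v ≡ newVal w i a v) →
               (is : Vec Instr m) → ∀ ps vs → zipWith g (zipWith _,_ is ps) vs ≡ storedAfter is ps vs
    pairwise g≗ []       []       []       = refl
    pairwise g≗ (i ∷ is) (p ∷ ps) (v ∷ vs) = cong₂ _∷_ (g≗ i p v) (pairwise g≗ is ps vs)

  take-storedAfter : ∀ m {m′} (is : Vec Instr (m + m′)) → ∀ ps vs →
    take m (storedAfter is ps vs) ≡ storedAfter (take m is) (take m ps) (take m vs)
  take-storedAfter m is ps vs = ≡-trans (take-zipWith _$_ (zipWith (newVal w) is ps) vs)
    (cong (λ fs → zipWith _$_ fs (take m vs)) (take-zipWith (newVal w) is ps))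

  drop-storedAfter : ∀ m {m′} (is : Vec Instr (m + m′)) → ∀ ps vs →
    drop m (storedAfter is ps vs) ≡ storedAfter (drop m is) (drop m ps) (drop m vs)
  drop-storedAfter m is ps vs = ≡-trans (drop-zipWith _$_ (zipWith (newVal w) is ps) vs)
    (cong (λ fs → zipWith _$_ fs (drop m vs)) (drop-zipWith (newVal w) is ps))

  storedAfter-honest : ∀ {m} (is : Vec Instr m) bs →
    storedAfter is bs (map (readCell w) bs) ≡ map (readCell w) (zipWith (moveAddr w) is bs)
  storedAfter-honest []         []       = refl
  storedAfter-honest (fwd ∷ is) (b ∷ bs) = cong (_ ∷_) (storedAfter-honest is bs)
  storedAfter-honest (bwd ∷ is) (b ∷ bs) = cong (_ ∷_) (storedAfter-honest is bs)
  storedAfter-honest (eps ∷ is) (b ∷ bs) = cong (_ ∷_) (storedAfter-honest is bs)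

  move-eps : ∀ {m} (bs : Vec (Cell w) m) → zipWith (moveAddr w) (replicate m eps) bs ≡ bs
  move-eps []       = refl
  move-eps (b ∷ bs) = cong (b ∷_) (move-eps bs)

  storedAfter-eps : ∀ {m} (bs : Vec (Cell w) m) cs → storedAfter (replicate m eps) bs cs ≡ cs
  storedAfter-eps []       []       = refl
  storedAfter-eps (b ∷ bs) (c ∷ cs) = cong (c ∷_) (storedAfter-eps bs cs)

  digit : Cell w → ℕ
  digit zero    = k
  digit (suc a) = toℕ a

  digit-fwd : ∀ b → digit (moveAddr w fwd b) ≡ toℕ b
  digit-fwd b with m≤n⇒m<n∨m≡n (Fin.toℕ<n b)
  ... | inj₁ below = digit-suc (moveAddr w fwd b) (≡-trans (Fin.toℕ-fromℕ< _) (m<n⇒m%n≡m below))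
    where
    digit-suc : ∀ x {j} → toℕ x ≡ suc j → digit x ≡ j
    digit-suc (suc a) e = suc-injective e
  ... | inj₂ last = ≡-trans (digit-zero (moveAddr w fwd b) (≡-trans (Fin.toℕ-fromℕ< _)
                              (≡-trans (cong (ℕ._% n) last) (n%n≡0 n))))
                            (suc-injective (sym last))
    where
    digit-zero : ∀ x → toℕ x ≡ 0 → digit x ≡ k
    digit-zero zero _ = refl

  value : ∀ {m} → Vec (Cell w) m → ℕ
  value []       = 0
  value (b ∷ bs) = digit b + n * value bs

  readCell≢star : ∀ a → readCell w (suc a) ≢ star
  readCell≢star a with List.lookup w a
  ... | false = λ ()
  ... | true  = λ ()

  value-inc : ∀ {m} (bs : Vec (Cell w) m) → ¬ Full (map (readCell w) bs) →
              value (zipWith (moveAddr w) (inc (map (readCell w) bs)) bs) ≡ suc (value bs)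
  value-inc []          ¬full = ⊥-elim (¬full [])
  value-inc (zero ∷ bs) ¬full = begin
      digit (moveAddr w fwd zero) + n * value (zipWith (moveAddr w) (inc (map (readCell w) bs)) bs)
    ≡⟨ cong₂ _+_ (digit-fwd zero) (cong (n *_) (value-inc bs (¬full-tail ¬full))) ⟩
      n * suc (value bs)
    ≡⟨ *-suc n (value bs) ⟩
      suc (value (zero ∷ bs))
    ∎
    where open ≡-Reasoning
  value-inc (suc a ∷ bs) _ with List.lookup w a
  ... | false rewrite move-eps bs | digit-fwd (suc {k} a) = refl
  ... | true  rewrite move-eps bs | digit-fwd (suc {k} a) = refl

  value-full : ∀ {m} (bs : Vec (Cell w) m) → Full (map (readCell w) bs) → suc (value bs) ≡ n ^ m
  value-full []            []            = refl
  value-full (zero ∷ bs)   (_ ∷ full)    = ≡-trans (sym (*-suc n (value bs))) (cong (n *_) (value-full bs full))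
  value-full (suc a ∷ bs)  (nonstar ∷ _) = ⊥-elim (readCell≢star a nonstar)

  value-wrap : ∀ {m} (bs : Vec (Cell w) m) → Full (map (readCell w) bs) →
               value (zipWith (moveAddr w) (inc (map (readCell w) bs)) bs) ≡ 0
  value-wrap []           []            = refl
  value-wrap (zero ∷ bs)  (_ ∷ full)    =
    cong₂ _+_ (digit-fwd zero) (≡-trans (cong (n *_) (value-wrap bs full)) (*-zeroʳ n))
  value-wrap (suc a ∷ bs) (nonstar ∷ _) = ⊥-elim (readCell≢star a nonstar)

  full-start : ∀ m → Full (map (readCell w) (replicate m zero))
  full-start zero    = []
  full-start (suc m) = refl ∷ full-start m

  -- A potential for counters whose stored values need not agree with the
  -- tape (possible from an arbitrary initial pseudo-configuration): a pointer
  -- at b storing c weighs n if c is ⋆ and toℕ b otherwise; weights are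
  -- combined in base R.
  R : ℕ
  R = suc n

  weight : Cell w → Sym → ℕ
  weight b star = n
  weight b s0   = toℕ b
  weight b s1   = toℕ b

  weight≤n : ∀ b c → weight b c ≤ n
  weight≤n b star = ≤-refl
  weight≤n b s0   = <⇒≤ (Fin.toℕ<n b)
  weight≤n b s1   = <⇒≤ (Fin.toℕ<n b)

  weight-fwd : ∀ b c → weight (moveAddr w fwd b) (newVal w fwd b c) ≡ suc (toℕ b)
  weight-fwd b c = ≡-trans (honest-weight (moveAddr w fwd b)) (cong suc (digit-fwd b))
    where
    honest-weight : ∀ x → weight x (readCell w x) ≡ suc (digit x)
    honest-weight zero = refl
    honest-weight (suc a) with List.lookup w a
    ... | false = refl
    ... | true  = refl

  potential : ∀ {m} → Vec (Cell w) m → Vec Sym m → ℕ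
  potential []       []       = 0
  potential (b ∷ bs) (c ∷ cs) = weight b c + R * potential bs cs

  potential<R^m : ∀ {m} (bs : Vec (Cell w) m) cs → potential bs cs < R ^ m
  potential<R^m []       []       = s≤s z≤n
  potential<R^m {suc m} (b ∷ bs) (c ∷ cs) = begin-strict
      weight b c + R * potential bs cs
    <⟨ +-monoˡ-< (R * potential bs cs) (s≤s (weight≤n b c)) ⟩
      R + R * potential bs cs
    ≡⟨ *-suc R (potential bs cs) ⟨
      R * suc (potential bs cs)
    ≤⟨ *-monoʳ-≤ R (potential<R^m bs cs) ⟩
      R * R ^ m
    ∎
    where open ≤-Reasoning

  potential-inc : ∀ {m} (bs : Vec (Cell w) m) cs → ¬ Full cs →
    potential bs cs < potential (zipWith (moveAddr w) (inc cs) bs) (storedAfter (inc cs) bs cs)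
  potential-inc []       []        ¬full = ⊥-elim (¬full [])
  potential-inc (b ∷ bs) (s0 ∷ cs) _
    rewrite move-eps bs | storedAfter-eps bs cs | weight-fwd b s0 = ≤-refl
  potential-inc (b ∷ bs) (s1 ∷ cs) _
    rewrite move-eps bs | storedAfter-eps bs cs | weight-fwd b s1 = ≤-refl
  potential-inc (b ∷ bs) (star ∷ cs) ¬full = begin-strict
      n + R * potential bs cs
    <⟨ ≤-refl ⟩
      R + R * potential bs cs
    ≡⟨ *-suc R (potential bs cs) ⟨
      R * suc (potential bs cs)
    ≤⟨ *-monoʳ-≤ R (potential-inc bs cs (¬full-tail ¬full)) ⟩
      R * potential bs′ cs′
    ≤⟨ m≤n+m _ (weight (moveAddr w fwd b) (newVal w fwd b star)) ⟩
      weight (moveAddr w fwd b) (newVal w fwd b star) + R * potential bs′ cs′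
    ∎
    where
    open ≤-Reasoning
    bs′ = zipWith (moveAddr w) (inc cs) bs
    cs′ = storedAfter (inc cs) bs cs

  codeConfig : ∀ {N : NDPM} → Config N w → Fin (3 ^ p N * q N * n ^ p N)
  codeConfig (cfg ps vs s) = combine (combine (codeVec SymCode.code vs) s) (codeVec id ps)

  codeConfig-injective : ∀ {N : NDPM} → Injective _≡_ _≡_ (codeConfig {N})
  codeConfig-injective {x = cfg ps vs s} {cfg ps′ vs′ s′} e
    with Fin.combine-injective (combine (codeVec SymCode.code vs) s) (codeVec id ps)
                               (combine (codeVec SymCode.code vs′) s′) (codeVec id ps′) e
  ... | e₁ , eps′ with Fin.combine-injective (codeVec SymCode.code vs) s (codeVec SymCode.code vs′) s′ e₁
  ... | evs , refl
    with codeVec-injective SymCode.code SymCode.code-injective {vs} {vs′} evs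
       | codeVec-injective id id {ps} {ps′} eps′
  ... | refl | refl = refl

-- The clocked machine M′ built from M.  Its pointers are those of M followed
-- by P counter pointers; its states are pairs (s , t) of a state of M and a
-- clock value t ≤ T₀, coded by combine.
module Clocked (M : NDPM) where

  P Q : ℕ
  P = p M
  Q = q M

  -- T₀ is the number of pseudo-configurations of M, so that T₀ · n ^ P
  -- bounds the number of configurations of M on an input of length n - 1.
  T₀ T : ℕ
  T₀ = 3 ^ P * Q
  T  = suc T₀

  Overflow : Vec Sym P → Fin T → Set
  Overflow cs t = Full cs × toℕ t ≡ T₀

  ClockStep : Vec Sym P → Fin T → Fin T → Set
  ClockStep cs t t′ = (Full cs × toℕ t′ ≡ suc (toℕ t)) ⊎ (¬ Full cs × t′ ≡ t)

  Enabled : Vec Sym P → Vec Sym P → Fin Q → Fin T → Target (P + P) (Q * T) → Set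
  Enabled vs cs s t accept     = ¬ Overflow cs t × trans M (vs , s) accept ≡ true
  Enabled vs cs s t reject     = Overflow cs t ⊎ trans M (vs , s) reject ≡ true
  Enabled vs cs s t (go ins u) = ¬ Overflow cs t
                               × trans M (vs , s) (go (take P ins) (quotient T u)) ≡ true
                               × drop P ins ≡ inc cs
                               × ClockStep cs t (remainder {Q} T u)

  overflow? : ∀ cs t → Dec (Overflow cs t)
  overflow? cs t = full? cs ×-dec (toℕ t ℕ.≟ T₀)

  clockStep? : ∀ cs t t′ → Dec (ClockStep cs t t′)
  clockStep? cs t t′ = (full? cs ×-dec (toℕ t′ ℕ.≟ suc (toℕ t))) ⊎-dec (¬? (full? cs) ×-dec (t′ Fin.≟ t))

  enabled? : ∀ vs cs s t tg → Dec (Enabled vs cs s t tg)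
  enabled? vs cs s t accept     = ¬? (overflow? cs t) ×-dec (trans M (vs , s) accept Bool.≟ true)
  enabled? vs cs s t reject     = overflow? cs t ⊎-dec (trans M (vs , s) reject Bool.≟ true)
  enabled? vs cs s t (go ins u) =
    ¬? (overflow? cs t) ×-dec
    (trans M (vs , s) (go (take P ins) (quotient T u)) Bool.≟ true) ×-dec
    ≡-dec InstrCode._≟_ (drop P ins) (inc cs) ×-dec
    clockStep? cs t (remainder {Q} T u)

  clockedTrans : PseudoConfig (P + P) (Q * T) → Target (P + P) (Q * T) → Bool
  clockedTrans (vs , u) tg = does (enabled? (take P vs) (drop P vs) (quotient T u) (remainder {Q} T u) tg)

  M′ : NDPM
  M′ = record { p = P + P ; p≥1 = ≤-trans (p≥1 M) (m≤m+n P P) ; q = Q * T ; trans = clockedTrans }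

  -- The initial pseudo-configuration of M′ for c: the counter pointers
  -- store ⋆, matching cell 0, and the clock is 0.
  start : PseudoConfig P Q → PseudoConfig (P + P) (Q * T)
  start (vs , s) = vs ++ replicate P star , combine s zero

  module OnInput (w : List Bool) where
    open Tape w

    simulated : Config M′ w → Config M w
    simulated X = cfg (take P (addrs X)) (take P (vals X)) (quotient T (state X))

    ctrAddrs : Config M′ w → Vec (Cell w) P
    ctrAddrs X = drop P (addrs X)

    ctrVals : Config M′ w → Vec Sym P
    ctrVals X = drop P (vals X)

    clock : Config M′ w → Fin T
    clock X = remainder {Q} T (state X)

    EnabledAt : Config M′ w → Target (P + P) (Q * T) → Set
    EnabledAt X = Enabled (take P (vals X)) (ctrVals X) (quotient T (state X)) (clock X)

    enabled⇒ : ∀ X tg → trans M′ (pseudo X) tg ≡ true → EnabledAt X tg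
    enabled⇒ X tg = does-true⇒ (enabled? _ _ _ _ tg)

    ⇒enabled : ∀ X tg → EnabledAt X tg → trans M′ (pseudo X) tg ≡ true
    ⇒enabled X tg = dec-true (enabled? _ _ _ _ tg)

    simulated-step : ∀ X ins u → simulated (step X ins u) ≡ step (simulated X) (take P ins) (quotient T u)
    simulated-step X ins u = cfg-cong (take-zipWith (moveAddr w) ins (addrs X)) stored refl
      where
      open ≡-Reasoning
      stored : take P (vals (step X ins u)) ≡ vals (step (simulated X) (take P ins) (quotient T u))
      stored = begin
          take P (vals (step X ins u))
        ≡⟨ cong (take P) (vals-step X ins u) ⟩
          take P (storedAfter ins (addrs X) (vals X))
        ≡⟨ take-storedAfter P ins (addrs X) (vals X) ⟩
          storedAfter (take P ins) (take P (addrs X)) (take P (vals X))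
        ≡⟨ vals-step (simulated X) (take P ins) (quotient T u) ⟨
          vals (step (simulated X) (take P ins) (quotient T u))
        ∎

    ctrAddrs-step : ∀ X ins u → ctrAddrs (step X ins u) ≡ zipWith (moveAddr w) (drop P ins) (ctrAddrs X)
    ctrAddrs-step X ins u = drop-zipWith (moveAddr w) ins (addrs X)

    ctrVals-step : ∀ X ins u → ctrVals (step X ins u) ≡ storedAfter (drop P ins) (ctrAddrs X) (ctrVals X)
    ctrVals-step X ins u =
      ≡-trans (cong (drop P) (vals-step X ins u)) (drop-storedAfter P ins (addrs X) (vals X))

    below-top : ∀ {cs t} → Full cs → ¬ Overflow cs t → toℕ t < T₀
    below-top {t = t} full ¬ov = ≤∧≢⇒< (s≤s⁻¹ (Fin.toℕ<n t)) (λ top → ¬ov (full , top))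

    -- Every transition of M′ either advances the clock, which is bounded by
    -- T₀, or keeps it and increases the (bounded) potential of the counter.
    measure : Config M′ w → ℕ × ℕ
    measure X = T₀ ∸ toℕ (clock X) , R ^ P ∸ potential (ctrAddrs X) (ctrVals X)

    measure-decreases : ∀ {X Y} → X ⟶ Y → ×-Lex _≡_ _<_ _<_ (measure Y) (measure X)
    measure-decreases {X} (⟶-go {ins} {u} e) with enabled⇒ X (go ins u) e
    ... | ¬ov , _ , _ , inj₁ (full , tick) = inj₁ (begin-strict
        T₀ ∸ toℕ (remainder {Q} T u)
      ≡⟨ cong (T₀ ∸_) tick ⟩
        T₀ ∸ suc (toℕ (clock X))
      <⟨ ∸-monoʳ-< (n<1+n _) (below-top full ¬ov) ⟩
        T₀ ∸ toℕ (clock X)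
      ∎)
      where open ≤-Reasoning
    ... | _ , _ , incs , inj₂ (¬full , same) =
      inj₂ (cong (λ t → T₀ ∸ toℕ t) same ,
            ∸-monoʳ-< (subst (potential (ctrAddrs X) (ctrVals X) <_) (sym after)
                             (potential-inc (ctrAddrs X) (ctrVals X) ¬full))
                      (<⇒≤ (potential<R^m (ctrAddrs Y) (ctrVals Y))))
      where
      Y = step X ins u
      after : potential (ctrAddrs Y) (ctrVals Y) ≡
              potential (zipWith (moveAddr w) (inc (ctrVals X)) (ctrAddrs X))
                        (storedAfter (inc (ctrVals X)) (ctrAddrs X) (ctrVals X))
      after = cong₂ potential
        (≡-trans (ctrAddrs-step X ins u) (cong (λ is → zipWith (moveAddr w) is (ctrAddrs X)) incs))
        (≡-trans (ctrVals-step X ins u) (cong (λ is → storedAfter is (ctrAddrs X) (ctrVals X)) incs))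

    clock-advance : ∀ cs t → ¬ Overflow cs t → ∃ (ClockStep cs t)
    clock-advance cs t ¬ov with full? cs
    ... | yes full = fromℕ< (s≤s (below-top full ¬ov)) , inj₁ (full , Fin.toℕ-fromℕ< (s≤s (below-top full ¬ov)))
    ... | no ¬full = t , inj₂ (¬full , refl)

    accepting-no-overflow : ∀ {X} → Accepts X → ¬ Overflow (ctrVals X) (clock X)
    accepting-no-overflow {X} a ov = accepts-no-reject a (⇒enabled X reject (inj₁ ov))

    lift : ∀ X {is s} → ¬ Overflow (ctrVals X) (clock X) →
           trans M (pseudo (simulated X)) (go is s) ≡ true →
           ∃ λ ins → ∃ λ u → trans M′ (pseudo X) (go ins u) ≡ true ×
                             simulated (step X ins u) ≡ step (simulated X) is s
    lift X {is} {s} ¬ov e with clock-advance (ctrVals X) (clock X) ¬ov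
    ... | t′ , tick = ins , u , ⇒enabled X (go ins u) (¬ov , e′ , drop-++ is _ , tick′) , sim
      where
      ins = is ++ inc (ctrVals X)
      u   = combine s t′
      quotient-u : quotient T u ≡ s
      quotient-u = cong proj₁ (Fin.remQuot-combine s t′)
      e′ : trans M (pseudo (simulated X)) (go (take P ins) (quotient T u)) ≡ true
      e′ = subst₂ (λ is′ s′ → trans M (pseudo (simulated X)) (go is′ s′) ≡ true)
                  (sym (take-++ is _)) (sym quotient-u) e
      tick′ : ClockStep (ctrVals X) (clock X) (remainder {Q} T u)
      tick′ = subst (ClockStep (ctrVals X) (clock X)) (sym (cong proj₂ (Fin.remQuot-combine s t′))) tick
      sim : simulated (step X ins u) ≡ step (simulated X) is s
      sim = ≡-trans (simulated-step X ins u) (cong₂ (step (simulated X)) (take-++ is _) quotient-u)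

    sound : ∀ {X} → Accepts X → Accepts (simulated X)
    sound {X} a@(acc f) = acc enabled-accepts
      where
      enabled-accepts : ∀ tg → trans M (pseudo (simulated X)) tg ≡ true → AcceptsT (simulated X) tg
      enabled-accepts accept    _ = t-accept
      enabled-accepts reject    e = ⊥-elim (accepts-no-reject a (⇒enabled X reject (inj₂ e)))
      enabled-accepts (go is s) e with lift X (accepting-no-overflow a) e
      ... | ins , u , e′ , sim with f (go ins u) e′
      ...   | t-go a′ = t-go (subst Accepts sim (sound a′))

    -- The counter and the clock together count the transitions
    -- taken so far; the configurations of M met along the way are pairwise
    -- distinct (accepting configurations lie on no cycle), so there are at
    -- most T₀ · n ^ P of them, fewer than an overflow requires.
    ticks : Config M′ w → ℕ
    ticks X = toℕ (clock X) * n ^ P + value (ctrAddrs X)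

    Honest : Config M′ w → Set
    Honest X = ctrVals X ≡ map (readCell w) (ctrAddrs X)

    ticks-step : ∀ X {ins u} → Honest X → trans M′ (pseudo X) (go ins u) ≡ true →
                 ticks (step X ins u) ≡ suc (ticks X)
    ticks-step X {ins} {u} honest e with enabled⇒ X (go ins u) e
    ... | _ , _ , incs , clockStep = advance clockStep
      where
      open ≡-Reasoning
      bs = ctrAddrs X
      t  = toℕ (clock X)
      addrs′ : ctrAddrs (step X ins u) ≡ zipWith (moveAddr w) (inc (map (readCell w) bs)) bs
      addrs′ = ≡-trans (ctrAddrs-step X ins u)
                       (cong (λ is → zipWith (moveAddr w) is bs) (≡-trans incs (cong inc honest)))
      advance : ClockStep (ctrVals X) (clock X) (remainder {Q} T u) → ticks (step X ins u) ≡ suc (ticks X)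
      advance (inj₁ (full , tick)) = begin
          toℕ (remainder {Q} T u) * n ^ P + value (ctrAddrs (step X ins u))
        ≡⟨ cong₂ (λ t′ v → t′ * n ^ P + v) tick (≡-trans (cong value addrs′) (value-wrap bs full′)) ⟩
          suc t * n ^ P + 0
        ≡⟨ +-identityʳ _ ⟩
          n ^ P + t * n ^ P
        ≡⟨ +-comm (n ^ P) _ ⟩
          t * n ^ P + n ^ P
        ≡⟨ cong (t * n ^ P +_) (value-full bs full′) ⟨
          t * n ^ P + suc (value bs)
        ≡⟨ +-suc _ _ ⟩
          suc (ticks X)
        ∎
        where
        full′ : Full (map (readCell w) bs)
        full′ = subst Full honest full
      advance (inj₂ (¬full , same)) = begin
          toℕ (remainder {Q} T u) * n ^ P + value (ctrAddrs (step X ins u))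
        ≡⟨ cong₂ (λ t′ v → toℕ t′ * n ^ P + v) same
                 (≡-trans (cong value addrs′) (value-inc bs (subst (λ cs → ¬ Full cs) honest ¬full))) ⟩
          t * n ^ P + suc (value bs)
        ≡⟨ +-suc _ _ ⟩
          suc (ticks X)
        ∎

    -- The run of M′ at X tracks the run of M at c, whose history hs consists of
    -- distinct configurations leading to c, one per tick.
    record Invariant (c : Config M w) (X : Config M′ w) {m} (hs : Vec (Config M w) m) : Set where
      field
        tracks   : simulated X ≡ c
        honest   : Honest X
        distinct : Unique (c ∷ hs)
        leads    : All (_⟶* c) hs
        elapsed  : m + n ^ P ≡ suc (ticks X)

    enabled-along : ∀ {X c tg} → simulated X ≡ c →
                    trans M (pseudo (simulated X)) tg ≡ true → trans M (pseudo c) tg ≡ true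
    enabled-along {tg = tg} = subst (λ Z → trans M (pseudo Z) tg ≡ true)

    -- Overflow would need T₀ · n ^ P + 1 distinct configurations of M.
    invariant-no-overflow : ∀ {c X m} {hs : Vec (Config M w) m} →
                            Invariant c X hs → ¬ Overflow (ctrVals X) (clock X)
    invariant-no-overflow {X = X} {m} inv (full , top) = <-irrefl steps too-many
      where
      open Invariant inv
      open ≡-Reasoning
      steps : m ≡ T₀ * n ^ P
      steps = +-cancelʳ-≡ (n ^ P) m (T₀ * n ^ P) (begin
          m + n ^ P
        ≡⟨ elapsed ⟩
          suc (ticks X)
        ≡⟨ +-suc _ _ ⟨
          toℕ (clock X) * n ^ P + suc (value (ctrAddrs X))
        ≡⟨ cong₂ (λ t v → t * n ^ P + v) top (value-full (ctrAddrs X) (subst Full honest full)) ⟩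
          T₀ * n ^ P + n ^ P
        ∎)
      too-many : suc m ≤ T₀ * n ^ P
      too-many = unique-length≤ codeConfig codeConfig-injective distinct

    invariant-step : ∀ {c X m} {hs : Vec (Config M w) m} {ins u} →
      Invariant c X hs → trans M′ (pseudo X) (go ins u) ≡ true →
      Accepts (step c (take P ins) (quotient T u)) →
      Invariant (step c (take P ins) (quotient T u)) (step X ins u) (c ∷ hs)
    invariant-step {c} {X} {ins = ins} {u} inv e a′ = record
      { tracks   = ≡-trans (simulated-step X ins u) (cong (λ Z → step Z (take P ins) (quotient T u)) tracks)
      ; honest   = honest′
      ; distinct = accepting-fresh a′ transition (ε ∷ leads) ∷ distinct
      ; leads    = All.map (λ r → r ◅◅ (transition ◅ ε)) (ε ∷ leads)
      ; elapsed  = cong suc (≡-trans elapsed (sym (ticks-step X honest e)))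
      }
      where
      open Invariant inv
      open ≡-Reasoning
      transition : c ⟶ step c (take P ins) (quotient T u)
      transition = ⟶-go (enabled-along tracks (proj₁ (proj₂ (enabled⇒ X (go ins u) e))))
      bs = ctrAddrs X
      honest′ : Honest (step X ins u)
      honest′ = begin
          ctrVals (step X ins u)
        ≡⟨ ctrVals-step X ins u ⟩
          storedAfter (drop P ins) bs (ctrVals X)
        ≡⟨ cong (storedAfter (drop P ins) bs) honest ⟩
          storedAfter (drop P ins) bs (map (readCell w) bs)
        ≡⟨ storedAfter-honest (drop P ins) bs ⟩
          map (readCell w) (zipWith (moveAddr w) (drop P ins) bs)
        ≡⟨ cong (map (readCell w)) (ctrAddrs-step X ins u) ⟨
          map (readCell w) (ctrAddrs (step X ins u))
        ∎

    complete : ∀ {c X m} {hs : Vec (Config M w) m} → Accepts c → Invariant c X hs → Accepts X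
    complete {c} {X} a@(acc f) inv = acc enabled-accepts
      where
      open Invariant inv
      enabled-accepts : ∀ tg → trans M′ (pseudo X) tg ≡ true → AcceptsT X tg
      enabled-accepts accept _ = t-accept
      enabled-accepts reject e with enabled⇒ X reject e
      ... | inj₁ ov = ⊥-elim (invariant-no-overflow inv ov)
      ... | inj₂ r  = ⊥-elim (accepts-no-reject a (enabled-along tracks r))
      enabled-accepts (go ins u) e with enabled⇒ X (go ins u) e
      ... | _ , e₁ , _ with f (go (take P ins) (quotient T u)) (enabled-along tracks e₁)
      ...   | t-go a′ = t-go (complete a′ (invariant-step inv e a′))

    simulated-start : ∀ c → simulated (init M′ w (start c)) ≡ init M w c
    simulated-start (vs , s) =
      cfg-cong (take-replicate P zero) (take-++ vs _) (cong proj₁ (Fin.remQuot-combine s zero))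

    invariant-start : ∀ c → Invariant (init M w c) (init M′ w (start c)) []
    invariant-start c@(vs , s) = record
      { tracks   = simulated-start c
      ; honest   = ≡-trans (drop-++ vs _) (≡-trans (sym (map-replicate (readCell w) zero P))
                                                   (cong (map (readCell w)) (sym (drop-replicate P zero))))
      ; distinct = [] ∷ []
      ; leads    = []
      ; elapsed  = ≡-trans (sym (value-full (replicate P zero) (full-start P)))
                          (cong₂ (λ t bs → suc (toℕ t * n ^ P + value bs))
                                 (sym (cong proj₂ (Fin.remQuot-combine s zero)))
                                 (sym (drop-replicate P zero)))
      }

  acyclic : Acyclic M′
  acyclic c w = halts-by-measure (×-wellFounded <-wellFounded <-wellFounded) measure measure-decreases
                                 (init M′ w c)
    where open OnInput w

lemma2 : (M : NDPM) (S : List Bool → Set) → Decides M S →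
    Σ NDPM (λ M′ → Acyclic M′ × Decides M′ S)
lemma2 M S (c , decides) = M′ , acyclic , start c , λ w →
  let open OnInput w in
  (λ accepts′ → proj₁ (decides w) (subst Accepts (simulated-start c) (sound accepts′))) ,
  (λ inS → complete (proj₂ (decides w) inS) (invariant-start c))
  where open Clocked M
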